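{- Fix $d\ge 1$ and finite families $\mathcal{F}_1,\dots,\mathcal{F}_d$ of finite graphs, and let $\Pi_i$ be the class of graphs with no induced subgraph isomorphic to a member of $\mathcal{F}_i$. Let $G$ be a graph, let $C \subseteq V(G)$ be a forbidden set of $G$, and let $Z$ be a $(\Pi_1,\dots,\Pi_d)$-modulator of $G$. Then $Z \cap C \neq \emptyset$ or $Z$ disconnects $C$.
   Context: A set $Z\subseteq V(G)$ is a $(\Pi_1,\dots,\Pi_d)$-modulator of $G$ if every connected component of $G - Z$ belongs to at least one of $\Pi_1,\dots,\Pi_d$. A set $C \subseteq V(G)$ is a forbidden set of $G$ if $C$ is contained in a single connected component of $G$, for every $i \in [d]$ there is $C_i \subseteq C$ such that $G[C_i]$ is isomorphic to a member of $\mathcal{F}_i$, and $C$ is inclusion-minimal with these properties. A set $Z$ disconnects a set $S$ if there are distinct $v, w \in S$ lying in different connected components of $G - Z$. -}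

module Defs where

open import Data.Nat using (ℕ; suc; _≤_)
open import Data.Fin using (Fin)
open import Data.Fin.Subset using (Subset; _∈_; _∉_; _⊆_; ∁; ⊤)
open import Data.Bool using (Bool; true; false)
open import Data.List using (List)
open import Data.List.Membership.Propositional using () renaming (_∈_ to _∈ₗ_)
open import Data.Product using (Σ; ∃; _×_; _,_)
open import Relation.Binary.PropositionalEquality using (_≡_)
open import Relation.Nullary using (¬_)
open import Function.Definitions using (Injective)

record Graph : Set where
  field
    n      : ℕ
    adj    : Fin n → Fin n → Bool
    sym    : ∀ u v → adj u v ≡ adj v u
    irrefl : ∀ v → adj v v ≡ false
open Graph public

data Walk (G : Graph) (X : Subset (n G)) : Fin (n G) → Fin (n G) → Set where
  here : ∀ {u} → u ∈ X → Walk G X u u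
  step : ∀ {u w v} → u ∈ X → adj G u w ≡ true → Walk G X w v → Walk G X u v

-- The vertex set of the connected component of G - Z containing v (for v ∉ Z).
InComponent : (G : Graph) (Z : Subset (n G)) → Fin (n G) → Fin (n G) → Set
InComponent G Z v u = Walk G (∁ Z) v u

-- G[S] contains an induced subgraph isomorphic to H, i.e. there is some
-- S' ⊆ S with G[S'] ≅ H; written out as an injective map V(H) → S
-- preserving adjacency and non-adjacency.
HasInducedCopy : (G : Graph) (S : Fin (n G) → Set) (H : Graph) → Set
HasInducedCopy G S H =
  Σ (Fin (n H) → Fin (n G)) λ f →
    Injective _≡_ _≡_ f × (∀ a → S (f a)) × (∀ a b → adj H a b ≡ adj G (f a) (f b))

InPi : (F : List Graph) (G : Graph) (S : Fin (n G) → Set) → Set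
InPi F G S = ∀ H → H ∈ₗ F → ¬ HasInducedCopy G S H

-- Z is a (Π_1,…,Π_d)-modulator: every connected component of G - Z
-- (= set of vertices reachable in G - Z from some v ∉ Z) is in some Π_i.
Modulator : {d : ℕ} (Fam : Fin d → List Graph) (G : Graph) (Z : Subset (n G)) → Set
Modulator {d} Fam G Z =
  ∀ v → v ∉ Z → ∃ λ (i : Fin d) → InPi (Fam i) G (InComponent G Z v)

ForbiddenProps : {d : ℕ} (Fam : Fin d → List Graph) (G : Graph) (C : Subset (n G)) → Set
ForbiddenProps {d} Fam G C =
  (∃ λ v → ∀ u → u ∈ C → Walk G ⊤ v u) ×
  (∀ (i : Fin d) → ∃ λ H → H ∈ₗ Fam i × HasInducedCopy G (λ u → u ∈ C) H)

Forbidden : {d : ℕ} (Fam : Fin d → List Graph) (G : Graph) (C : Subset (n G)) → Set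
Forbidden Fam G C =
  ForbiddenProps Fam G C × (∀ C' → C' ⊆ C → ForbiddenProps Fam G C' → C ⊆ C')

Disconnects : (G : Graph) (Z S : Subset (n G)) → Set
Disconnects G Z S =
  ∃ λ v → ∃ λ w → v ∈ S × w ∈ S × ¬ (v ≡ w) × v ∉ Z × w ∉ Z × ¬ Walk G (∁ Z) v w

-- If Z misses C, pick v ∈ C (any copy of a member of F₁ is nonempty). The
-- component of v in G − Z lies in some Π_i, yet C contains an induced copy of a
-- member of F_i, so some vertex of that copy is unreachable from v in G − Z. Reachability in a
-- finite graph is decidable, which makes "some vertex is unreachable"
-- constructive.
module Submission where

open import Defs
open import Data.Nat using (ℕ; _≤_; _<_; suc; s≤s)
open import Data.Nat.Properties using (≤-trans)
open import Data.Fin using (Fin; zero; suc; fromℕ<; _≟_)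
open import Data.Fin.Subset using (Subset; _∩_; Nonempty; _∈_; _∉_; _⊆_; ∁; _-_; ∣_∣)
open import Data.Fin.Subset.Properties using (_∈?_; nonempty?; x∉p⇒x∈∁p; x∈p∩q⁺; x∈p∧x≢y⇒x∈p-y; x∈p⇒∣p-x∣<∣p∣; p─q⊆p; ∣p∣≤n)
open import Data.Fin.Properties using (any?; all?; ¬∀⟶∃¬)
open import Data.Bool using (true)
import Data.Bool as Bool
open import Data.List using (List)
open import Data.List.Membership.Propositional using () renaming (_∈_ to _∈ₗ_)
open import Data.List.Relation.Unary.All using (All)
import Data.List.Relation.Unary.All as All
open import Data.Vec using (_∷_; there)
open import Data.Sum using (_⊎_; inj₁; inj₂)
open import Data.Product using (∃; _×_; _,_)
open import Data.Empty using (⊥-elim)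
open import Function using (_∘_)
open import Function.Bundles using (_⇔_; mk⇔)
open import Relation.Nullary using (¬_; Dec; yes; no)
open import Relation.Nullary.Decidable using (_×-dec_)
import Relation.Nullary.Decidable as Dec
open import Relation.Binary.PropositionalEquality using (_≡_; _≢_; refl)

x∉p-x : ∀ {m} {p : Subset m} {x : Fin m} → x ∉ p - x
x∉p-x {p = _ ∷ p} {x = suc x} (there x∈p-x) = x∉p-x x∈p-x

empty∩⇒∉ : ∀ {m} {p q : Subset m} {x} → ¬ Nonempty (p ∩ q) → x ∈ q → x ∉ p
empty∩⇒∉ p∩q≡∅ x∈q x∈p = p∩q≡∅ (_ , x∈p∩q⁺ (x∈p , x∈q))

module _ (G : Graph) where

  Walk-source∈ : ∀ {X a b} → Walk G X a b → a ∈ X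
  Walk-source∈ (here a∈X)     = a∈X
  Walk-source∈ (step a∈X _ _) = a∈X

  Walk-mono : ∀ {X Y} → X ⊆ Y → ∀ {a b} → Walk G X a b → Walk G Y a b
  Walk-mono X⊆Y (here a∈X)       = here (X⊆Y a∈X)
  Walk-mono X⊆Y (step a∈X e rest) = step (X⊆Y a∈X) e (Walk-mono X⊆Y rest)

  Walk≢⇒avoids⊎leaves : ∀ {X a v} (u : Fin (n G)) → u ≢ v → Walk G X a v →
    Walk G (X - u) a v ⊎ ∃ λ w → adj G u w ≡ true × Walk G (X - u) w v
  Walk≢⇒avoids⊎leaves {a = a} u u≢v (here a∈X) with a ≟ u
  ... | yes refl = ⊥-elim (u≢v refl)
  ... | no a≢u   = inj₁ (here (x∈p∧x≢y⇒x∈p-y a∈X a≢u))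
  Walk≢⇒avoids⊎leaves {a = a} u u≢v (step {w = w} a∈X e rest)
    with Walk≢⇒avoids⊎leaves u u≢v rest
  ... | inj₂ leaves = inj₂ leaves
  ... | inj₁ avoids with a ≟ u
  ...   | yes refl = inj₂ (w , e , avoids)
  ...   | no a≢u   = inj₁ (step (x∈p∧x≢y⇒x∈p-y a∈X a≢u) e avoids)

  Walk⇔firstStep : ∀ {X u v} → u ∈ X → u ≢ v →
    (∃ λ w → adj G u w ≡ true × Walk G (X - u) w v) ⇔ Walk G X u v
  Walk⇔firstStep {X} {u} {v} u∈X u≢v = mk⇔ to from
    where
    to : (∃ λ w → adj G u w ≡ true × Walk G (X - u) w v) → Walk G X u v
    to (w , e , rest) = step u∈X e (Walk-mono (p─q⊆p X _) rest)
    from : Walk G X u v → ∃ λ w → adj G u w ≡ true × Walk G (X - u) w v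
    from walk with Walk≢⇒avoids⊎leaves u u≢v walk
    ... | inj₁ avoids = ⊥-elim (x∉p-x (Walk-source∈ avoids))
    ... | inj₂ leaves = leaves

  -- The recursion removes the current vertex from X, so it is bounded by ∣ X ∣.
  Walk?-bounded : ∀ k X → ∣ X ∣ < k → ∀ u v → Dec (Walk G X u v)
  Walk?-bounded k X _ u v with u ∈? X | u ≟ v
  ... | no u∉X  | _        = no (u∉X ∘ Walk-source∈)
  ... | yes u∈X | yes refl = yes (here u∈X)
  Walk?-bounded (suc k) X (s≤s ∣X∣≤k) u v | yes u∈X | no u≢v =
    Dec.map (Walk⇔firstStep u∈X u≢v) (any? λ w →
      (adj G u w Bool.≟ true) ×-dec
      Walk?-bounded k (X - u) (≤-trans (x∈p⇒∣p-x∣<∣p∣ u∈X) ∣X∣≤k) w v)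

  Walk? : ∀ X u v → Dec (Walk G X u v)
  Walk? X = Walk?-bounded (suc (n G)) X (s≤s (∣p∣≤n X))

  ¬Walk⇒≢ : ∀ {X u v} → u ∈ X → ¬ Walk G X u v → u ≢ v
  ¬Walk⇒≢ u∈X u↛v refl = u↛v (here u∈X)

HasInducedCopy⇒nonempty : ∀ G (S : Fin (n G) → Set) H → 1 ≤ n H → HasInducedCopy G S H → ∃ S
HasInducedCopy⇒nonempty _ _ _ 1≤∣H∣ (f , _ , inS , _) = f (fromℕ< 1≤∣H∣) , inS _

Modulator⇒unreachableCopyVertex :
  ∀ {d} {Fam : Fin d → List Graph} {G Z S} → Modulator Fam G Z →
  (∀ i → ∃ λ H → H ∈ₗ Fam i × HasInducedCopy G S H) →
  ∀ {v} → v ∉ Z → ∃ λ u → S u × ¬ Walk G (∁ Z) v u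
Modulator⇒unreachableCopyVertex {G = G} {Z} modulator copies {v} v∉Z
  with modulator v v∉Z
... | i , componentInΠᵢ with copies i
... | H , H∈Famᵢ , f , f-inj , inS , f-adj with all? (Walk? G (∁ Z) v ∘ f)
... | yes allReachable =
  ⊥-elim (componentInΠᵢ H H∈Famᵢ (f , f-inj , allReachable , f-adj))
... | no notAllReachable with ¬∀⟶∃¬ _ _ (Walk? G (∁ Z) v ∘ f) notAllReachable
... | a , v↛fa = f a , inS a , v↛fa

lemma3 : (d : ℕ) → 1 ≤ d → (Fam : Fin d → List Graph) →
    (∀ i → All (λ H → 1 ≤ n H) (Fam i)) →
    (G : Graph) (C Z : Subset (n G)) →
    Forbidden Fam G C → Modulator Fam G Z →
    Nonempty (Z ∩ C) ⊎ Disconnects G Z C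
lemma3 (suc d) _ Fam nonNull G C Z ((_ , copies) , _) modulator
  with nonempty? (Z ∩ C)
... | yes Z∩C≠∅ = inj₁ Z∩C≠∅
... | no Z∩C≡∅
  with copies zero
... | H , H∈Fam₀ , copy
  with HasInducedCopy⇒nonempty G (_∈ C) H (All.lookup (nonNull zero) H∈Fam₀) copy
... | v , v∈C
  with Modulator⇒unreachableCopyVertex modulator copies (empty∩⇒∉ Z∩C≡∅ v∈C)
... | u , u∈C , v↛u =
  let v∉Z = empty∩⇒∉ Z∩C≡∅ v∈C
      u∉Z = empty∩⇒∉ Z∩C≡∅ u∈C
  in inj₂ (v , u , v∈C , u∈C , ¬Walk⇒≢ G (x∉p⇒x∈∁p v∉Z) v↛u , v∉Z , u∉Z , v↛u)
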